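{- Let $1/n\ll\alpha\ll1$ and let $H$ be a $2$-graph on $n$ vertices with minimum degree $\delta(H)\ge(1-\alpha)n$. Suppose the edges of $H$ are coloured by a Gallai, locally $2$-edge-colouring $\phi$, with monochromatic components $H_1,\dots,H_m$ ordered so that $|V(H_1)|\ge\dots\ge|V(H_m)|$. Then: (g1) if $H_1$ spans $H$, then $H_2,\dots,H_m$ are pairwise vertex-disjoint and $|V(H_1)|=n$; (g2) if $H_1$ does not span $H$, then $|V(H_2)|\ge(1-2\alpha)n$ and $H_1\cup H_2$ spans $H$; (g3) $|V(H_1)|\ge(1-2\alpha)n$ and $|V(H_i)|\le n/2$ for all $i\in[3,m]$.
   Context: An edge colouring of a graph is a Gallai colouring if there is no rainbow triangle (a triangle whose three edges receive three distinct colours). It is a locally $2$-edge-colouring if at every vertex the edges incident to it receive at most two distinct colours. For each colour, the monochromatic component of that colour is the subgraph formed by all edges of that colour (with their incident vertices). A subgraph spans $H$ if its vertex set is $V(H)$. The notation $a\ll b$ means the statement holds whenever $a<f(b)$ for a suitable non-decreasing $f$. -}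

module Defs where

open import Data.Nat using (ℕ; suc)
open import Data.Fin using (Fin; toℕ)
open import Data.Fin.Properties using (any?)
open import Data.Fin.Subset using (Subset; ∣_∣)
open import Data.Maybe using (Maybe; just; nothing; is-just)
open import Data.Maybe.Properties using (≡-dec)
import Data.Fin.Properties as FinP
open import Data.Vec using (tabulate)
open import Data.Product using (∃; _×_)
open import Data.Sum using (_⊎_)
open import Data.Integer using (+_)
open import Data.Rational using (ℚ; _/_)
open import Relation.Nullary using (¬_)
open import Relation.Nullary.Decidable using (⌊_⌋)
open import Relation.Binary.PropositionalEquality using (_≡_; _≢_)

ℕ→ℚ : ℕ → ℚ
ℕ→ℚ k = + k / 1

-- An edge-coloured (simple, loopless, undirected) 2-graph on vertex set Fin n
-- with colours Fin m:  c u v ≡ nothing  means uv is not an edge,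
-- c u v ≡ just i  means uv is an edge of colour i.
record ColouredGraph (n m : ℕ) : Set where
  field
    col      : Fin n → Fin n → Maybe (Fin m)
    loopless : ∀ u → col u u ≡ nothing
    symm     : ∀ u v → col u v ≡ col v u
open ColouredGraph public

deg : ∀ {n m} → ColouredGraph n m → Fin n → ℕ
deg H u = ∣ tabulate (λ v → is-just (col H u v)) ∣

InV : ∀ {n m} → ColouredGraph n m → Fin m → Fin n → Set
InV H i u = ∃ λ v → col H u v ≡ just i

vsize : ∀ {n m} → ColouredGraph n m → Fin m → ℕ
vsize H i = ∣ tabulate (λ u → ⌊ any? (λ v → ≡-dec FinP._≟_ (col H u v) (just i)) ⌋) ∣

-- every colour is used (H_1,…,H_m are exactly the monochromatic components)
AllColoursUsed : ∀ {n m} → ColouredGraph n m → Set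
AllColoursUsed H = ∀ i → ∃ λ u → InV H i u

Gallai : ∀ {n m} → ColouredGraph n m → Set
Gallai H = ∀ u v w i j k → col H u v ≡ just i → col H v w ≡ just j →
  col H u w ≡ just k → i ≡ j ⊎ j ≡ k ⊎ i ≡ k

Local2 : ∀ {n m} → ColouredGraph n m → Set
Local2 H = ∀ u v w x i j k → col H u v ≡ just i → col H u w ≡ just j →
  col H u x ≡ just k → i ≡ j ⊎ j ≡ k ⊎ i ≡ k

Spans : ∀ {n m} → ColouredGraph n m → Fin m → Set
Spans H i = ∀ u → InV H i u

Spans2 : ∀ {n m} → ColouredGraph n m → Fin m → Fin m → Set
Spans2 H i j = ∀ u → InV H i u ⊎ InV H j u

Disjoint : ∀ {n m} → ColouredGraph n m → Fin m → Fin m → Set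
Disjoint H j k = ∀ u → ¬ (InV H j u × InV H k u)

-- Locally at most two colours meet at a vertex, so no vertex lies in three monochromatic
-- components; this gives (g1) at once. A vertex u of degree ≥ (1-α)n has an edge uv of some
-- colour a; if some neighbour w of u lies outside the a-component, Gallai and local
-- 2-colouring force every common neighbour of u and w into the component of uw, which
-- therefore has at least deg u + deg w - n ≥ (1-2α)n vertices (otherwise the a-component
-- itself is that big). So every vertex lies in a component of order ≥ (1-2α)n. If H₁ does not
-- span, a vertex outside it lies in such a component other than H₁, so H₂ is large too; a
-- vertex w outside H₁ ∪ H₂ would have its neighbourhood disjoint from V(H₁) ∩ V(H₂), i.e.
-- deg w + |V(H₁)| + |V(H₂)| ≤ 2n, impossible for α ≤ 1/10. For i ≥ 3 the same counting with
-- V(H_i) in place of the neighbourhood gives |V(H_i)| ≤ 4αn ≤ n/2; if H₁ spans, V(H₂) and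
-- V(H_i) are disjoint instead, and |V(H_i)| ≤ |V(H₂)|.
module Submission where

open import Defs
open import Data.Nat using (ℕ) renaming (_≤_ to _≤ℕ_; _*_ to _*ℕ_)

module _ where
  open import Data.Nat as ℕ using (z≤n)
  import Data.Nat.Properties as ℕ
  open import Data.Integer as ℤ using (+_)
  import Data.Integer.Properties as ℤ
  open import Data.Nat.Coprimality using (1-coprimeTo) renaming (sym to coprime-sym)
  open import Data.Rational
    using (ℚ; mkℚ; *≤*; 1ℚ; _+_; _-_; -_; _*_; _≤_; NonNegative; nonNegative)
    renaming (_/_ to _÷_)
  open import Data.Rational.Properties
    using (normalize-coprime; drop-*≤*; +-mono-≤; +-monoˡ-≤; *-monoˡ-≤-nonNeg; *-monoʳ-≤-nonNeg; *-identityˡ; module ≤-Reasoning)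
  open import Data.Rational.Solver using (module +-*-Solver)
  open import Relation.Binary.PropositionalEquality

  ℕ→ℚ≡mkℚ : ∀ k → ℕ→ℚ k ≡ mkℚ (+ k) 0 (coprime-sym (1-coprimeTo k))
  ℕ→ℚ≡mkℚ k = normalize-coprime (coprime-sym (1-coprimeTo k))

  ℕ→ℚ-homo-+ : ∀ a b → ℕ→ℚ (a ℕ.+ b) ≡ ℕ→ℚ a + ℕ→ℚ b
  ℕ→ℚ-homo-+ a b rewrite ℕ→ℚ≡mkℚ a | ℕ→ℚ≡mkℚ b =
    cong (_÷ 1) (sym (cong₂ ℤ._+_ (ℤ.*-identityʳ (+ a)) (ℤ.*-identityʳ (+ b))))

  ℕ→ℚ-homo-* : ∀ a b → ℕ→ℚ (a ℕ.* b) ≡ ℕ→ℚ a * ℕ→ℚ b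
  ℕ→ℚ-homo-* a b rewrite ℕ→ℚ≡mkℚ a | ℕ→ℚ≡mkℚ b = cong (_÷ 1) (ℤ.pos-* a b)

  ℕ→ℚ-mono-≤ : ∀ {a b} → a ℕ.≤ b → ℕ→ℚ a ≤ ℕ→ℚ b
  ℕ→ℚ-mono-≤ {a} {b} a≤b rewrite ℕ→ℚ≡mkℚ a | ℕ→ℚ≡mkℚ b =
    *≤* (subst₂ ℤ._≤_ (sym (ℤ.*-identityʳ (+ a))) (sym (ℤ.*-identityʳ (+ b))) (ℤ.+≤+ a≤b))

  ℕ→ℚ-cancel-≤ : ∀ {a b} → ℕ→ℚ a ≤ ℕ→ℚ b → a ℕ.≤ b
  ℕ→ℚ-cancel-≤ {a} {b} a≤b rewrite ℕ→ℚ≡mkℚ a | ℕ→ℚ≡mkℚ b =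
    ℤ.drop‿+≤+ (subst₂ ℤ._≤_ (ℤ.*-identityʳ (+ a)) (ℤ.*-identityʳ (+ b)) (drop-*≤* a≤b))

  ℕ→ℚ-nonNegative : ∀ k → NonNegative (ℕ→ℚ k)
  ℕ→ℚ-nonNegative k = nonNegative (ℕ→ℚ-mono-≤ {0} {k} z≤n)

  α₀ : ℚ
  α₀ = + 1 ÷ 10

  -- For α ≤ 1/10 the rational bound (1 - kα)n ≤ x gives x ≥ (1 - k/10)n, cleared of denominators.
  ≤-tenfold : ∀ k n x {α} → α ≤ α₀ → (1ℚ - ℕ→ℚ k * α) * ℕ→ℚ n ≤ ℕ→ℚ x →
              10 ℕ.* n ℕ.≤ 10 ℕ.* x ℕ.+ k ℕ.* n
  ≤-tenfold k n x {α} α≤α₀ bound = ℕ→ℚ-cancel-≤ (begin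
    ℕ→ℚ (10 ℕ.* n)                                 ≡⟨ ℕ→ℚ-homo-* 10 n ⟩
    ten * N                                         ≡⟨ split K α N ⟩
    ten * ((1ℚ - K * α) * N) + K * ((ten * α) * N)  ≤⟨ +-mono-≤ (*-monoˡ-≤-nonNeg ten bound)
                                                         (*-monoˡ-≤-nonNeg K {{ℕ→ℚ-nonNegative k}}
                                                           (*-monoʳ-≤-nonNeg N {{ℕ→ℚ-nonNegative n}} tenα≤1)) ⟩
    ten * ℕ→ℚ x + K * (1ℚ * N)                      ≡⟨ cong (λ y → ten * ℕ→ℚ x + K * y) (*-identityˡ N) ⟩
    ten * ℕ→ℚ x + K * N                             ≡⟨ cong₂ _+_ (ℕ→ℚ-homo-* 10 x) (ℕ→ℚ-homo-* k n) ⟨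
    ℕ→ℚ (10 ℕ.* x) + ℕ→ℚ (k ℕ.* n)                  ≡⟨ ℕ→ℚ-homo-+ (10 ℕ.* x) (k ℕ.* n) ⟨
    ℕ→ℚ (10 ℕ.* x ℕ.+ k ℕ.* n)                      ∎)
    where
    open ≤-Reasoning
    open +-*-Solver
    ten K N : ℚ
    ten = ℕ→ℚ 10
    K = ℕ→ℚ k
    N = ℕ→ℚ n
    tenα≤1 : ten * α ≤ 1ℚ
    tenα≤1 = *-monoˡ-≤-nonNeg ten α≤α₀
    split : ∀ K α N → ten * N ≡ ten * ((1ℚ - K * α) * N) + K * ((ten * α) * N)
    split = solve 3 (λ K α N → con ten :* N := con ten :* ((con 1ℚ :- K :* α) :* N) :+ K :* ((con ten :* α) :* N)) refl

  deficits-add : ∀ {α} n x y z → x ℕ.+ y ℕ.≤ n ℕ.+ z →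
                 (1ℚ - α) * ℕ→ℚ n ≤ ℕ→ℚ x → (1ℚ - α) * ℕ→ℚ n ≤ ℕ→ℚ y →
                 (1ℚ - ℕ→ℚ 2 * α) * ℕ→ℚ n ≤ ℕ→ℚ z
  deficits-add {α} n x y z x+y≤n+z x-bound y-bound = begin
    (1ℚ - ℕ→ℚ 2 * α) * N                ≡⟨ double α N ⟩
    ((1ℚ - α) * N + (1ℚ - α) * N) - N   ≤⟨ +-monoˡ-≤ (- N) (+-mono-≤ x-bound y-bound) ⟩
    ℕ→ℚ x + ℕ→ℚ y - N                   ≡⟨ cong (_- N) (ℕ→ℚ-homo-+ x y) ⟨
    ℕ→ℚ (x ℕ.+ y) - N                   ≤⟨ +-monoˡ-≤ (- N) (ℕ→ℚ-mono-≤ x+y≤n+z) ⟩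
    ℕ→ℚ (n ℕ.+ z) - N                   ≡⟨ cong (_- N) (ℕ→ℚ-homo-+ n z) ⟩
    N + ℕ→ℚ z - N                       ≡⟨ cancel N (ℕ→ℚ z) ⟩
    ℕ→ℚ z                               ∎
    where
    open ≤-Reasoning
    open +-*-Solver
    N : ℚ
    N = ℕ→ℚ n
    double : ∀ α N → (1ℚ - ℕ→ℚ 2 * α) * N ≡ ((1ℚ - α) * N + (1ℚ - α) * N) - N
    double = solve 2 (λ α N → (con 1ℚ :- con (ℕ→ℚ 2) :* α) :* N := ((con 1ℚ :- α) :* N :+ (con 1ℚ :- α) :* N) :- N) refl
    cancel : ∀ N Z → N + Z - N ≡ Z
    cancel = solve 2 (λ N Z → N :+ Z :- N := Z) refl

module _ where
  open import Data.Nat using (zero; suc; z≤n; s≤s; _+_; _*_; _≤_; _<_; _≤?_; >-nonZero)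
  open import Data.Nat.Properties
  open import Algebra.Properties.CommutativeSemigroup +-commutativeSemigroup using (x∙yz≈y∙xz)
  open import Data.Nat.Solver using (module +-*-Solver)
  open import Data.Empty using (⊥)
  open import Relation.Nullary using (contradiction)
  open import Relation.Nullary.Decidable using (from-no)
  open import Relation.Binary.PropositionalEquality

  tenfold-positive : ∀ n d → 0 < n → 10 * n ≤ 10 * d + 1 * n → 0 < d
  tenfold-positive n zero    0<n 10n≤n = contradiction (*-cancelʳ-≤ 10 1 n {{>-nonZero 0<n}} 10n≤n) (from-no (10 ≤? 1))
  tenfold-positive _ (suc _) _   _     = s≤s z≤n

  tenfold-remainder : ∀ l k n x y z → x + y + z ≤ n + n →
                      10 * n ≤ 10 * y + l * n → 10 * n ≤ 10 * z + k * n → 10 * x ≤ (l + k) * n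
  tenfold-remainder l k n x y z sum y-bound z-bound = +-cancelʳ-≤ (20 * n) _ _ (begin
    10 * x + 20 * n                                  ≡⟨ split x n ⟩
    10 * x + 10 * n + 10 * n                         ≤⟨ +-mono-≤ (+-monoʳ-≤ (10 * x) y-bound) z-bound ⟩
    10 * x + (10 * y + l * n) + (10 * z + k * n)     ≡⟨ regroup x y z l k n ⟩
    10 * (x + y + z) + (l + k) * n                   ≤⟨ +-monoˡ-≤ ((l + k) * n) (*-monoʳ-≤ 10 sum) ⟩
    10 * (n + n) + (l + k) * n                       ≡⟨ swap n l k ⟩
    (l + k) * n + 20 * n                             ∎)
    where
    open ≤-Reasoning
    open +-*-Solver
    split : ∀ x n → 10 * x + 20 * n ≡ 10 * x + 10 * n + 10 * n
    split = solve 2 (λ x n → con 10 :* x :+ con 20 :* n := con 10 :* x :+ con 10 :* n :+ con 10 :* n) refl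
    regroup : ∀ x y z l k n → 10 * x + (10 * y + l * n) + (10 * z + k * n) ≡ 10 * (x + y + z) + (l + k) * n
    regroup = solve 6 (λ x y z l k n → con 10 :* x :+ (con 10 :* y :+ l :* n) :+ (con 10 :* z :+ k :* n)
                                      := con 10 :* (x :+ y :+ z) :+ (l :+ k) :* n) refl
    swap : ∀ n l k → 10 * (n + n) + (l + k) * n ≡ (l + k) * n + 20 * n
    swap = solve 3 (λ n l k → con 10 :* (n :+ n) :+ (l :+ k) :* n := (l :+ k) :* n :+ con 20 :* n) refl

  tenfold-incompatible : ∀ n x → 0 < n → 10 * n ≤ 10 * x + 1 * n → 10 * x ≤ 4 * n → ⊥
  tenfold-incompatible n x 0<n lower upper = contradiction (*-cancelʳ-≤ 10 5 n {{>-nonZero 0<n}} (begin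
    10 * n          ≤⟨ lower ⟩
    10 * x + 1 * n  ≤⟨ +-monoˡ-≤ (1 * n) upper ⟩
    4 * n + 1 * n   ≡⟨ *-distribʳ-+ n 4 1 ⟨
    5 * n           ∎)) (from-no (10 ≤? 5))
    where open ≤-Reasoning

  10x≤4n⇒2x≤n : ∀ n x → 10 * x ≤ 4 * n → 2 * x ≤ n
  10x≤4n⇒2x≤n n x 10x≤4n = *-cancelˡ-≤ 5 (begin
    5 * (2 * x)  ≡⟨ *-assoc 5 2 x ⟨
    10 * x       ≤⟨ 10x≤4n ⟩
    4 * n        ≤⟨ *-monoˡ-≤ n (n≤1+n 4) ⟩
    5 * n        ∎)
    where open ≤-Reasoning

  x+n+y≤n+n⇒2x≤n : ∀ n x y → x + n + y ≤ n + n → x ≤ y → 2 * x ≤ n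
  x+n+y≤n+n⇒2x≤n n x y sum x≤y = +-cancelˡ-≤ n _ _ (begin
    n + 2 * x      ≡⟨ cong (λ t → n + (x + t)) (+-identityʳ x) ⟩
    n + (x + x)    ≤⟨ +-monoʳ-≤ n (+-monoʳ-≤ x x≤y) ⟩
    n + (x + y)    ≡⟨ x∙yz≈y∙xz n x y ⟩
    x + (n + y)    ≡⟨ +-assoc x n y ⟨
    x + n + y      ≤⟨ sum ⟩
    n + n          ∎)
    where open ≤-Reasoning

module _ where
  open import Data.Nat using (suc; _+_; _≤_; _<_)
  open import Data.Nat.Properties
  open import Algebra.Properties.CommutativeSemigroup +-commutativeSemigroup using (x∙yz≈y∙xz)
  open import Data.Fin using (Fin)
  open import Data.Fin.Subset using (Subset; Side; inside; outside; _∈_; _∩_; _∪_; ∣_∣; Empty; Nonempty)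
  open import Data.Fin.Subset.Properties using (∣p∣≤n; ∣⊥∣≡0; ∣⊤∣≡n; Empty-unique; ⊆-antisym; ⊆⊤; nonempty?)
  open import Data.Vec using ([]; _∷_; tabulate)
  open import Data.Vec.Properties using (lookup∘tabulate; []=⇒lookup; lookup⇒[]=)
  open import Relation.Nullary using (yes; no; contradiction)
  open import Relation.Binary.PropositionalEquality

  ∈tabulate⁺ : ∀ {n} {f : Fin n → Side} {x} → f x ≡ inside → x ∈ tabulate f
  ∈tabulate⁺ {f = f} {x} fx = lookup⇒[]= x (tabulate f) (trans (lookup∘tabulate f x) fx)

  ∈tabulate⁻ : ∀ {n} {f : Fin n → Side} {x} → x ∈ tabulate f → f x ≡ inside
  ∈tabulate⁻ {f = f} {x} x∈ = trans (sym (lookup∘tabulate f x)) ([]=⇒lookup x∈)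

  ∣p∩q∣+∣p∪q∣≡∣p∣+∣q∣ : ∀ {n} (p q : Subset n) → ∣ p ∩ q ∣ + ∣ p ∪ q ∣ ≡ ∣ p ∣ + ∣ q ∣
  ∣p∩q∣+∣p∪q∣≡∣p∣+∣q∣ []            []            = refl
  ∣p∩q∣+∣p∪q∣≡∣p∣+∣q∣ (inside  ∷ p) (inside  ∷ q) = cong suc (begin
    ∣ p ∩ q ∣ + suc ∣ p ∪ q ∣    ≡⟨ +-suc _ _ ⟩
    suc (∣ p ∩ q ∣ + ∣ p ∪ q ∣)  ≡⟨ cong suc (∣p∩q∣+∣p∪q∣≡∣p∣+∣q∣ p q) ⟩
    suc (∣ p ∣ + ∣ q ∣)          ≡⟨ +-suc _ _ ⟨
    ∣ p ∣ + suc ∣ q ∣            ∎)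
    where open ≡-Reasoning
  ∣p∩q∣+∣p∪q∣≡∣p∣+∣q∣ (inside  ∷ p) (outside ∷ q) =
    trans (+-suc _ _) (cong suc (∣p∩q∣+∣p∪q∣≡∣p∣+∣q∣ p q))
  ∣p∩q∣+∣p∪q∣≡∣p∣+∣q∣ (outside ∷ p) (inside  ∷ q) =
    trans (+-suc _ _) (trans (cong suc (∣p∩q∣+∣p∪q∣≡∣p∣+∣q∣ p q)) (sym (+-suc _ _)))
  ∣p∩q∣+∣p∪q∣≡∣p∣+∣q∣ (outside ∷ p) (outside ∷ q) = ∣p∩q∣+∣p∪q∣≡∣p∣+∣q∣ p q

  ∣p∣+∣q∣≤n+∣p∩q∣ : ∀ {n} (p q : Subset n) → ∣ p ∣ + ∣ q ∣ ≤ n + ∣ p ∩ q ∣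
  ∣p∣+∣q∣≤n+∣p∩q∣ {n} p q = begin
    ∣ p ∣ + ∣ q ∣          ≡⟨ ∣p∩q∣+∣p∪q∣≡∣p∣+∣q∣ p q ⟨
    ∣ p ∩ q ∣ + ∣ p ∪ q ∣  ≤⟨ +-monoʳ-≤ ∣ p ∩ q ∣ (∣p∣≤n (p ∪ q)) ⟩
    ∣ p ∩ q ∣ + n          ≡⟨ +-comm _ n ⟩
    n + ∣ p ∩ q ∣          ∎
    where open ≤-Reasoning

  Empty⇒∣p∣≡0 : ∀ {n} {p : Subset n} → Empty p → ∣ p ∣ ≡ 0
  Empty⇒∣p∣≡0 {n} empty = trans (cong ∣_∣ (Empty-unique empty)) (∣⊥∣≡0 n)

  Empty[p∩q]⇒∣p∣+∣q∣≤n : ∀ {n} (p q : Subset n) → Empty (p ∩ q) → ∣ p ∣ + ∣ q ∣ ≤ n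
  Empty[p∩q]⇒∣p∣+∣q∣≤n {n} p q empty = begin
    ∣ p ∣ + ∣ q ∣  ≤⟨ ∣p∣+∣q∣≤n+∣p∩q∣ p q ⟩
    n + ∣ p ∩ q ∣  ≡⟨ cong (n +_) (Empty⇒∣p∣≡0 empty) ⟩
    n + 0          ≡⟨ +-identityʳ n ⟩
    n              ∎
    where open ≤-Reasoning

  Empty[p∩q∩r]⇒∣p∣+∣q∣+∣r∣≤n+n : ∀ {n} (p q r : Subset n) → Empty (p ∩ q ∩ r) →
                                 ∣ p ∣ + ∣ q ∣ + ∣ r ∣ ≤ n + n
  Empty[p∩q∩r]⇒∣p∣+∣q∣+∣r∣≤n+n {n} p q r empty = begin
    ∣ p ∣ + ∣ q ∣ + ∣ r ∣    ≡⟨ +-assoc ∣ p ∣ _ _ ⟩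
    ∣ p ∣ + (∣ q ∣ + ∣ r ∣)  ≤⟨ +-monoʳ-≤ ∣ p ∣ (∣p∣+∣q∣≤n+∣p∩q∣ q r) ⟩
    ∣ p ∣ + (n + ∣ q ∩ r ∣)  ≡⟨ x∙yz≈y∙xz ∣ p ∣ n _ ⟩
    n + (∣ p ∣ + ∣ q ∩ r ∣)  ≤⟨ +-monoʳ-≤ n (Empty[p∩q]⇒∣p∣+∣q∣≤n p (q ∩ r) empty) ⟩
    n + n                    ∎
    where open ≤-Reasoning

  full⇒∣p∣≡n : ∀ {n} (p : Subset n) → (∀ x → x ∈ p) → ∣ p ∣ ≡ n
  full⇒∣p∣≡n {n} p full = trans (cong ∣_∣ (⊆-antisym ⊆⊤ (λ {x} _ → full x))) (∣⊤∣≡n n)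

  ∣p∣>0⇒Nonempty : ∀ {n} (p : Subset n) → 0 < ∣ p ∣ → Nonempty p
  ∣p∣>0⇒Nonempty {n} p 0<∣p∣ with nonempty? p
  ... | yes nonempty = nonempty
  ... | no  empty    = contradiction (Empty⇒∣p∣≡0 empty) (>⇒≢ 0<∣p∣)

module Colouring {n m : ℕ} (H : ColouredGraph n m) where
  open import Data.Nat using (_+_; _≤_; _<_)
  open import Data.Nat.Properties using (+-mono-≤; +-monoʳ-≤; module ≤-Reasoning)
  open import Data.Bool using (true)
  open import Data.Fin using (Fin)
  open import Data.Fin.Properties using (any?; _≟_)
  open import Data.Fin.Subset using (Subset; _∈_; _∩_; _⊆_; ∣_∣; Empty)
  open import Data.Fin.Subset.Properties using (∣p∣≤n; _∈?_; x∈p∩q⁻; p⊆q⇒∣p∣≤∣q∣)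
  open import Data.Maybe using (Maybe; just; is-just)
  open import Data.Maybe.Properties using (≡-dec)
  open import Data.Vec using (tabulate)
  open import Data.Product using (_,_; ∃; ∃₂; _×_)
  open import Data.Sum using (_⊎_; inj₁; inj₂; [_,_]′)
  open import Data.Empty using (⊥)
  open import Relation.Nullary using (¬_; Dec; yes; no; _×-dec_; ¬?; contradiction)
  open import Relation.Nullary.Decidable using (⌊_⌋; dec-true; isYes≗does)
  open import Relation.Binary.PropositionalEquality

  InV? : (i : Fin m) (u : Fin n) → Dec (InV H i u)
  InV? i u = any? (λ v → ≡-dec _≟_ (col H u v) (just i))

  neighbours : Fin n → Subset n
  neighbours u = tabulate (λ v → is-just (col H u v))

  vertices : Fin m → Subset n
  vertices i = tabulate (λ u → ⌊ InV? i u ⌋)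

  edge-sym : ∀ {u v c} → col H u v ≡ just c → col H v u ≡ just c
  edge-sym {u} {v} uv = trans (symm H v u) uv

  ∈neighbours⁻ : ∀ {u v} → v ∈ neighbours u → ∃ λ c → col H u v ≡ just c
  ∈neighbours⁻ {u} {v} v∈ = is-just⇒≡just (col H u v) (∈tabulate⁻ v∈)
    where
    is-just⇒≡just : (x : Maybe (Fin m)) → is-just x ≡ true → ∃ λ c → x ≡ just c
    is-just⇒≡just (just c) _ = c , refl

  ∈vertices⁺ : ∀ {i u} → InV H i u → u ∈ vertices i
  ∈vertices⁺ {i} {u} u∈Vᵢ = ∈tabulate⁺ (trans (isYes≗does (InV? i u)) (dec-true (InV? i u) u∈Vᵢ))

  ∈vertices⁻ : ∀ {i u} → u ∈ vertices i → InV H i u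
  ∈vertices⁻ {i} {u} u∈ with InV? i u | ∈tabulate⁻ u∈
  ... | yes u∈Vᵢ | _ = u∈Vᵢ

  Spans⇒vsize≡n : ∀ {i} → Spans H i → vsize H i ≡ n
  Spans⇒vsize≡n {i} span = full⇒∣p∣≡n (vertices i) (λ u → ∈vertices⁺ (span u))

  module _ (local : Local2 H) where

    three-colours-disjoint : ∀ {i j k u} → i ≢ j → j ≢ k → i ≢ k →
                             InV H i u → InV H j u → InV H k u → ⊥
    three-colours-disjoint i≢j j≢k i≢k (v , uv) (w , uw) (x , ux) =
      [ i≢j , [ j≢k , i≢k ]′ ]′ (local _ v w x _ _ _ uv uw ux)

    vsize-three-distinct : ∀ {i j k} → i ≢ j → j ≢ k → i ≢ k →
                           vsize H i + vsize H j + vsize H k ≤ n + n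
    vsize-three-distinct i≢j j≢k i≢k = Empty[p∩q∩r]⇒∣p∣+∣q∣+∣r∣≤n+n _ _ _ empty
      where
      empty : Empty (vertices _ ∩ vertices _ ∩ vertices _)
      empty (u , u∈) with x∈p∩q⁻ _ _ u∈
      ... | u∈Vᵢ , u∈Vⱼ∩Vₖ with x∈p∩q⁻ _ _ u∈Vⱼ∩Vₖ
      ... | u∈Vⱼ , u∈Vₖ = three-colours-disjoint i≢j j≢k i≢k
                            (∈vertices⁻ u∈Vᵢ) (∈vertices⁻ u∈Vⱼ) (∈vertices⁻ u∈Vₖ)

    -- A neighbour x of w lies in the component of the colour of wx, which is neither i nor j.
    uncovered⇒deg+vsize+vsize≤n+n : ∀ {i j w} → i ≢ j → ¬ InV H i w → ¬ InV H j w →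
                                     deg H w + vsize H i + vsize H j ≤ n + n
    uncovered⇒deg+vsize+vsize≤n+n {i} {j} {w} i≢j w∉Vᵢ w∉Vⱼ = Empty[p∩q∩r]⇒∣p∣+∣q∣+∣r∣≤n+n _ _ _ empty
      where
      empty : Empty (neighbours w ∩ vertices i ∩ vertices j)
      empty (x , x∈) with x∈p∩q⁻ _ _ x∈
      ... | x∈N , x∈Vᵢ∩Vⱼ with x∈p∩q⁻ _ _ x∈Vᵢ∩Vⱼ | ∈neighbours⁻ x∈N
      ... | x∈Vᵢ , x∈Vⱼ | r , wx =
        three-colours-disjoint r≢i i≢j r≢j (w , edge-sym wx) (∈vertices⁻ x∈Vᵢ) (∈vertices⁻ x∈Vⱼ)
        where
        r≢i : r ≢ i
        r≢i refl = w∉Vᵢ (x , wx)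
        r≢j : r ≢ j
        r≢j refl = w∉Vⱼ (x , wx)

    module _ (gallai : Gallai H) where

      common-neighbours⊆vertices : ∀ {u v w a b} → col H u v ≡ just a → col H u w ≡ just b →
                                   ¬ InV H a w → neighbours u ∩ neighbours w ⊆ vertices b
      common-neighbours⊆vertices {u} {v} {w} {a} {b} uv uw w∉Vₐ {x} x∈ with x∈p∩q⁻ _ _ x∈
      ... | x∈Nᵤ , x∈N_w with ∈neighbours⁻ x∈Nᵤ | ∈neighbours⁻ x∈N_w
      ... | k , ux | j , wx = ∈vertices⁺ (x∈V_b (local u v w x a b k uv uw ux))
        where
        x∈V_b : a ≡ b ⊎ b ≡ k ⊎ a ≡ k → InV H b x
        x∈V_b (inj₁ refl)        = contradiction (u , edge-sym uw) w∉Vₐ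
        x∈V_b (inj₂ (inj₁ refl)) = u , edge-sym ux
        x∈V_b (inj₂ (inj₂ refl)) with gallai u w x b j a uw wx ux
        ... | inj₁ refl        = w , edge-sym wx
        ... | inj₂ (inj₁ refl) = contradiction (x , wx) w∉Vₐ
        ... | inj₂ (inj₂ refl) = u , edge-sym ux

      -- Take an edge uv, of colour a. If all neighbours of u lie in the a-component, choose w = u;
      -- otherwise choose a neighbour w outside it and bound the common neighbourhood of u and w.
      deg+deg≤n+vsize : ∀ u → 0 < deg H u →
                        ∃₂ λ c w → InV H c u × deg H u + deg H w ≤ n + vsize H c
      deg+deg≤n+vsize u 0<deg with ∣p∣>0⇒Nonempty (neighbours u) 0<deg
      ... | v , v∈Nᵤ with ∈neighbours⁻ v∈Nᵤ
      ... | a , uv with any? (λ w → (w ∈? neighbours u) ×-dec ¬? (InV? a w))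
      ... | yes (w , w∈Nᵤ , w∉Vₐ) with ∈neighbours⁻ w∈Nᵤ
      ...   | b , uw = b , w , (w , uw) , (begin
        deg H u + deg H w                    ≤⟨ ∣p∣+∣q∣≤n+∣p∩q∣ (neighbours u) (neighbours w) ⟩
        n + ∣ neighbours u ∩ neighbours w ∣  ≤⟨ +-monoʳ-≤ n (p⊆q⇒∣p∣≤∣q∣ (common-neighbours⊆vertices uv uw w∉Vₐ)) ⟩
        n + vsize H b                        ∎)
        where open ≤-Reasoning
      deg+deg≤n+vsize u 0<deg | v , v∈Nᵤ | a , uv | no none =
        a , u , (v , uv) , +-mono-≤ (∣p∣≤n (neighbours u)) (p⊆q⇒∣p∣≤∣q∣ Nᵤ⊆Vₐ)
        where
        Nᵤ⊆Vₐ : neighbours u ⊆ vertices a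
        Nᵤ⊆Vₐ {x} x∈Nᵤ with InV? a x
        ... | yes x∈Vₐ = ∈vertices⁺ x∈Vₐ
        ... | no  x∉Vₐ = contradiction (x , x∈Nᵤ , x∉Vₐ) none

module _ where
  open import Data.Nat using (z≤n; z<s; _+_; _*_; _≤_; _<_)
  open import Data.Nat.Properties using (≤-trans; ≤-reflexive; ≤-<-trans; <⇒≤; m<n⇒0<n; n≢0⇒n>0)
  open import Data.Rational as Q using (1ℚ)
  import Data.Rational.Properties as Q
  open import Data.Fin as F using (Fin; toℕ; fromℕ<)
  open import Data.Fin.Properties using (toℕ-injective; toℕ-fromℕ<; toℕ<n; <⇒≢; all?; ¬∀⟶∃¬)
  open import Data.Product using (Σ; _,_; ∃; _×_)
  open import Data.Sum using (inj₁; inj₂)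
  open import Relation.Nullary using (¬_; yes; no)
  open import Function using (case_of_)
  open import Data.Empty using (⊥-elim)
  open import Relation.Binary.PropositionalEquality

  index-below : ∀ {m k} (c : Fin m) → k ≤ toℕ c → ∃ λ (j : Fin m) → toℕ j ≡ k
  index-below c k≤c = fromℕ< (≤-<-trans k≤c (toℕ<n c)) , toℕ-fromℕ< _

  ≢-from-indices : ∀ {m a b} {i j : Fin m} → toℕ i ≡ a → toℕ j ≡ b → a < b → i ≢ j
  ≢-from-indices refl refl = <⇒≢

  module Lemma9p12
    {α : Q.ℚ} (α≤α₀ : α Q.≤ α₀) {n m : ℕ} (0<n : 0 < n) (H : ColouredGraph n m)
    (min-degree : ∀ u → (1ℚ Q.- α) Q.* ℕ→ℚ n Q.≤ ℕ→ℚ (deg H u))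
    (gallai : Gallai H) (local : Local2 H)
    (sorted : ∀ (i j : Fin m) → i F.≤ j → vsize H j ≤ vsize H i) where
    open Colouring H

    Large : ℕ → Set
    Large x = (1ℚ Q.- ℕ→ℚ 2 Q.* α) Q.* ℕ→ℚ n Q.≤ ℕ→ℚ x

    Large-mono : ∀ {x y} → x ≤ y → Large x → Large y
    Large-mono x≤y large = Q.≤-trans large (ℕ→ℚ-mono-≤ x≤y)

    Large-sorted : ∀ i j → toℕ j ≤ toℕ i → Large (vsize H i) → Large (vsize H j)
    Large-sorted i j j≤i = Large-mono (sorted j i j≤i)

    Large⇒tenfold : ∀ x → Large x → 10 * n ≤ 10 * x + 2 * n
    Large⇒tenfold x = ≤-tenfold 2 n x α≤α₀

    deg-tenfold : ∀ u → 10 * n ≤ 10 * deg H u + 1 * n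
    deg-tenfold u = ≤-tenfold 1 n (deg H u) α≤α₀
      (subst (λ a → (1ℚ Q.- a) Q.* ℕ→ℚ n Q.≤ ℕ→ℚ (deg H u)) (sym (Q.*-identityˡ α)) (min-degree u))

    large-component-at : ∀ u → ∃ λ c → InV H c u × Large (vsize H c)
    large-component-at u =
      let c , w , u∈V_c , sum = deg+deg≤n+vsize local gallai u (tenfold-positive n (deg H u) 0<n (deg-tenfold u))
      in  c , u∈V_c , deficits-add {α} n (deg H u) (deg H w) (vsize H c) sum (min-degree u) (min-degree w)

    first-large : ∀ i → toℕ i ≡ 0 → Large (vsize H i)
    first-large i i≡0 =
      let c , _ , large = large-component-at (fromℕ< 0<n)
      in  Large-sorted c i (≤-trans (≤-reflexive i≡0) z≤n) large

    first-colour-large : Σ (Fin m) λ i → toℕ i ≡ 0 × Large (vsize H i)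
    first-colour-large =
      let c , _ = large-component-at (fromℕ< 0<n)
          i , i≡0 = index-below c z≤n
      in  i , i≡0 , first-large i i≡0

    large-colour-beyond-first : ∀ {p} → toℕ p ≡ 0 → ¬ Spans H p → ∃ λ c → 0 < toℕ c × Large (vsize H c)
    large-colour-beyond-first {p} p≡0 ¬span =
      let u , u∉Vₚ = ¬∀⟶∃¬ n (InV H p) (InV? p) ¬span
          c , u∈V_c , large = large-component-at u
          c≢p : toℕ c ≢ 0
          c≢p c≡0 = u∉Vₚ (subst (λ j → InV H j u) (toℕ-injective (trans c≡0 (sym p≡0))) u∈V_c)
      in  c , n≢0⇒n>0 c≢p , large

    second-large : ∀ {p q} → toℕ p ≡ 0 → toℕ q ≡ 1 → ¬ Spans H p → Large (vsize H q)
    second-large {q = q} p≡0 q≡1 ¬span =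
      let c , 0<c , large = large-colour-beyond-first p≡0 ¬span
      in  Large-sorted c q (≤-trans (≤-reflexive q≡1) 0<c) large

    beside-two-large : ∀ x {p q} → x + vsize H p + vsize H q ≤ n + n →
                       Large (vsize H p) → Large (vsize H q) → 10 * x ≤ 4 * n
    beside-two-large x {p} {q} sum large-p large-q =
      tenfold-remainder 2 2 n x (vsize H p) (vsize H q) sum
        (Large⇒tenfold (vsize H p) large-p) (Large⇒tenfold (vsize H q) large-q)

    first-spanning : (i : Fin m) → toℕ i ≡ 0 → Spans H i →
                     ((j k : Fin m) → 1 ≤ toℕ j → 1 ≤ toℕ k → j ≢ k → Disjoint H j k) × vsize H i ≡ n
    first-spanning i i≡0 span = disjoint , Spans⇒vsize≡n span
      where
      disjoint : (j k : Fin m) → 1 ≤ toℕ j → 1 ≤ toℕ k → j ≢ k → Disjoint H j k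
      disjoint j k 0<j 0<k j≢k u (u∈Vⱼ , u∈Vₖ) = three-colours-disjoint local
        (≢-from-indices i≡0 refl 0<j) j≢k (≢-from-indices i≡0 refl 0<k) (span u) u∈Vⱼ u∈Vₖ

    first-not-spanning : (i : Fin m) → toℕ i ≡ 0 → ¬ Spans H i →
                         Σ (Fin m) λ j → toℕ j ≡ 1 × Large (vsize H j) × Spans2 H i j
    first-not-spanning i i≡0 ¬span =
      let c , 0<c , _ = large-colour-beyond-first i≡0 ¬span
          j , j≡1 = index-below c 0<c
          largeⱼ = second-large i≡0 j≡1 ¬span
      in  j , j≡1 , largeⱼ , covered j≡1 largeⱼ
      where
      covered : ∀ {j} → toℕ j ≡ 1 → Large (vsize H j) → Spans2 H i j
      covered {j} j≡1 largeⱼ w with InV? i w | InV? j w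
      ... | yes w∈Vᵢ | _        = inj₁ w∈Vᵢ
      ... | no _     | yes w∈Vⱼ = inj₂ w∈Vⱼ
      ... | no w∉Vᵢ  | no w∉Vⱼ  = ⊥-elim (tenfold-incompatible n (deg H w) 0<n (deg-tenfold w)
        (beside-two-large (deg H w)
          (uncovered⇒deg+vsize+vsize≤n+n local (≢-from-indices i≡0 j≡1 z<s) w∉Vᵢ w∉Vⱼ)
          (first-large i i≡0) largeⱼ))

    later-small : (i : Fin m) → 2 ≤ toℕ i → 2 * vsize H i ≤ n
    later-small i 1<i =
      let p , p≡0 = index-below i z≤n
          q , q≡1 = index-below i (<⇒≤ 1<i)
          sum = vsize-three-distinct local
                  (≢-sym (≢-from-indices p≡0 refl (m<n⇒0<n 1<i))) (≢-from-indices p≡0 q≡1 z<s)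
                  (≢-sym (≢-from-indices q≡1 refl 1<i))
          vᵢ≤v_q = sorted q i (≤-trans (≤-reflexive q≡1) (<⇒≤ 1<i))
      in  case all? (InV? p) of λ where
            (yes span)  → x+n+y≤n+n⇒2x≤n n (vsize H i) (vsize H q)
                            (subst (λ t → vsize H i + t + vsize H q ≤ n + n) (Spans⇒vsize≡n span) sum) vᵢ≤v_q
            (no ¬span) → 10x≤4n⇒2x≤n n (vsize H i)
                            (beside-two-large (vsize H i) sum (first-large p p≡0) (second-large p≡0 q≡1 ¬span))

open import Data.Fin using (Fin; toℕ)
import Data.Fin as F
open import Data.Product using (Σ; ∃; _×_; _,_)
open import Data.Rational using (ℚ; 0ℚ; 1ℚ; _<_; _≤_; _-_; _*_)
open import Relation.Nullary using (¬_)
open import Relation.Binary.PropositionalEquality using (_≡_; _≢_)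
open import Data.Rational.Properties using (positive⁻¹)

lemma9p12 : Σ ℚ λ α₀ → 0ℚ < α₀ × ((α : ℚ) → 0ℚ < α → α ≤ α₀ →
    ∃ λ n₀ → (n m : ℕ) → n₀ ≤ℕ n → (H : ColouredGraph n m) →
      (∀ u → (1ℚ - α) * ℕ→ℚ n ≤ ℕ→ℚ (deg H u)) →
      Gallai H → Local2 H → AllColoursUsed H →
      (∀ (i j : Fin m) → i F.≤ j → vsize H j ≤ℕ vsize H i) →
      ((i : Fin m) → toℕ i ≡ 0 → Spans H i →
          ((j k : Fin m) → 1 ≤ℕ toℕ j → 1 ≤ℕ toℕ k → j ≢ k → Disjoint H j k)
          × vsize H i ≡ n)
      × ((i : Fin m) → toℕ i ≡ 0 → ¬ Spans H i →
          Σ (Fin m) λ j → toℕ j ≡ 1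
            × (1ℚ - (ℕ→ℚ 2 * α)) * ℕ→ℚ n ≤ ℕ→ℚ (vsize H j)
            × Spans2 H i j)
      × (Σ (Fin m) λ i → toℕ i ≡ 0 × (1ℚ - (ℕ→ℚ 2 * α)) * ℕ→ℚ n ≤ ℕ→ℚ (vsize H i))
      × ((i : Fin m) → 2 ≤ℕ toℕ i → 2 *ℕ vsize H i ≤ℕ n))
lemma9p12 = α₀ , positive⁻¹ α₀ , λ α _ α≤α₀ → 1 , λ n m 0<n H min-degree gallai local _ sorted →
  let open Lemma9p12 α≤α₀ 0<n H min-degree gallai local sorted
  in  first-spanning , first-not-spanning , first-colour-large , later-small
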